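{- Let $H$ be a homogeneous relation on a finite set $X$, given by its matrix representation, and let $S\subseteq X$ be non-empty. The following algorithm outputs $SM(S)$ and runs in $O(|X|\cdot|SM(S)|)=O(|X|^2)$ time: pick $x\in S$, set $M:=\{x\}$ and $F:=S\setminus\{x\}$; while $F\neq\emptyset$, pick $y\in F$, set $F:=F\setminus\{y\}$, $M:=M\cup\{y\}$, and for every $z\notin M\cup F$ with $\neg H(z|xy)$ set $F:=F\cup\{z\}$; finally output $M$.
   Context: A diverse triple of $X$ is $(x,y,z)\in X^3$ with $x\neq y$, $x\neq z$, written $(x|yz)$. A homogeneous relation $H$ on $X$ is a relation on diverse triples such that for every $x\in X$ the relation $H_x(y,z)\Leftrightarrow H(x|yz)$ is an equivalence relation on $X\setminus\{x\}$. $M\subseteq X$ is a homogeneous module if $H(x|mm')$ for all $m,m'\in M$, $x\in X\setminus M$. For non-empty $S\subseteq X$, $SM(S)$ is the smallest homogeneous module containing $S$ (the intersection of all homogeneous modules containing $S$). Matrix representation: with $X=\{x_1,\dots,x_n\}$, an $n\times n$ matrix $A$ with entries in $\{1,\dots,n\}$ where the classes of each $H_{x_i}$ get distinct numbers and $A_{i,j}=k$ iff $x_j$ lies in the class of $H_{x_i}$ numbered $k$ (so $H(x_i|x_px_q)$ is tested in $O(1)$ time). -}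

module Defs where

open import Data.Nat using (ℕ; suc; _+_)
open import Data.Product using (_×_; _,_)
open import Data.Bool using (Bool; not; _∧_)
open import Data.Fin using (Fin; _≟_)
open import Data.Fin.Subset using (Subset; _∈_; _∉_; _⊆_; _∪_; _-_; ⁅_⁆; Empty)
open import Data.Vec using (tabulate; lookup)
open import Relation.Binary.PropositionalEquality using (_≡_; _≢_)
open import Relation.Nullary.Decidable using (⌊_⌋)

-- A homogeneous relation on X is given by its matrix
-- representation  A : Fin n → Fin n → Fin n  (row x, column y = number of
-- the class of H_x containing y).  Diagonal entries are irrelevant.
Matrix : ℕ → Set
Matrix n = Fin n → Fin n → Fin n

H : ∀ {n} → Matrix n → Fin n → Fin n → Fin n → Set
H A x y z = (x ≢ y) × (x ≢ z) × (A x y ≡ A x z)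

IsModule : ∀ {n} → Matrix n → Subset n → Set
IsModule A M = ∀ {m m' x} → m ∈ M → m' ∈ M → x ∉ M → H A x m m'

_∈SM_ : ∀ {n} → Fin n → (Matrix n × Subset n) → Set
z ∈SM (A , S) = ∀ (M : Subset _) → IsModule A M → S ⊆ M → z ∈ M

-- The algorithm, as a (nondeterministic) transition system.
-- State: current M, current F, and an operation counter.

record State (n : ℕ) : Set where
  constructor ⟨_,_,_⟩
  field
    Mset : Subset n
    Fset : Subset n
    cost : ℕ
open State public

-- the z's added in one iteration: z ∉ R (R = M ∪ F) and ¬ H(z|xy)
-- (for z ∉ R we have z ≠ x, z ≠ y, so ¬H(z|xy) ⇔ A z x ≠ A z y)
newCands : ∀ {n} → Matrix n → Fin n → Fin n → Subset n → Subset n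
newCands A x y R = tabulate λ z → not (lookup R z) ∧ not ⌊ A z x ≟ A z y ⌋

-- Cost model: building the initial state costs n units; one iteration
-- (remove y from F, add y to M, scan all z ∈ X with O(1) matrix tests)
-- costs n + 1 units.
initState : ∀ {n} → Subset n → Fin n → State n
initState {n} S x = ⟨ ⁅ x ⁆ , S - x , n ⟩

data Step {n} (A : Matrix n) (x : Fin n) : State n → State n → Set where
  step : ∀ {M F c y} → y ∈ F →
         Step A x ⟨ M , F , c ⟩
                  ⟨ M ∪ ⁅ y ⁆
                  , (F - y) ∪ newCands A x y ((M ∪ ⁅ y ⁆) ∪ (F - y))
                  , c + suc n ⟩

Terminal : ∀ {n} → State n → Set
Terminal s = Empty (Fset s)

-- Throughout the loop the algorithm keeps M ∪ F inside SM(S) (a newly added z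
-- separates x and y, both already in every module containing S, so z must lie
-- in that module too), keeps S ⊆ M ∪ F, and keeps every z outside M ∪ F from
-- separating x from any y ∈ M (y was compared against all such z when it was
-- moved into M).  When F is empty, the last property says that M is a module,
-- hence M = SM(S).  Each iteration moves one element from F to M at cost n + 1,
-- which bounds both the number of iterations and the total cost by 2n|M|.
module Submission where

open import Defs
open import Data.Nat using (ℕ; _*_; _≤_; suc; _+_; _∸_; _<_; >-nonZero⁻¹)
open import Data.Product using (∃; _×_; _,_; proj₁; proj₂)
open import Data.Fin using (Fin; _≟_)
open import Data.Fin.Subset using (Subset; _∈_; Nonempty; ∣_∣; _∉_; _⊆_; _∪_; _─_; _-_; ⁅_⁆; inside; outside)
open import Function.Bundles using (_⇔_; mk⇔)
open import Induction.WellFounded using (Acc; acc)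
open import Relation.Binary.Construct.Closure.ReflexiveTransitive using (Star; ε; _◅_)
open import Data.Bool using (true; not; _∧_)
open import Data.Empty using (⊥-elim)
open import Data.Fin.Properties using (nonZeroIndex)
open import Data.Fin.Subset.Properties
  using (_∈?_; ∪-assoc; x∈⁅x⁆; x∈⁅y⁆⇒x≡y; ∣⁅x⁆∣≡1; ∣p∣≤n; p⊆p∪q; q⊆p∪q; x∈p∪q⁻; x∈p∪q⁺;
         p─q⊆p; x∈p∧x≢y⇒x∈p-y; p⊂q⇒∣p∣<∣q∣)
open import Data.Nat.Induction using (<-wellFounded)
open import Data.Nat.Properties
  using (+-mono-≤; *-monoʳ-≤; *-suc; *-identityʳ; +-comm; m≤m+n; ∸-monoʳ-<; module ≤-Reasoning)
open import Data.Sum using (_⊎_; inj₁; inj₂)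
open import Data.Vec using (lookup; _∷_; here; there)
open import Data.Vec.Properties using (lookup∘tabulate; []=⇒lookup; lookup⇒[]=)
open import Relation.Binary.PropositionalEquality using (_≡_; _≢_; refl; sym; trans; cong; subst)
open import Relation.Nullary using (yes; no; contradiction)
open import Relation.Nullary.Decidable using (⌊_⌋)

private
  variable
    n : ℕ

x∈p─q⇒x∉q : ∀ {p q : Subset n} {z} → z ∈ p ─ q → z ∉ q
x∈p─q⇒x∉q {p = inside ∷ _} {q = inside ∷ _} () here
x∈p─q⇒x∉q {p = outside ∷ _} {q = inside ∷ _} () here
x∈p─q⇒x∉q {p = _ ∷ _} {q = _ ∷ _} (there z∈p─q) (there z∈q) = x∈p─q⇒x∉q z∈p─q z∈q

x∉p⇒lookup≡outside : ∀ {p : Subset n} {z} → z ∉ p → lookup p z ≡ outside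
x∉p⇒lookup≡outside {p = p} {z} z∉p with lookup p z in p[z]
... | outside = refl
... | inside = contradiction (lookup⇒[]= z p p[z]) z∉p

x∈p-y⇒x≢y : ∀ {p : Subset n} {y z} → z ∈ p - y → z ≢ y
x∈p-y⇒x≢y z∈p-y refl = x∈p─q⇒x∉q z∈p-y (x∈⁅x⁆ _)

x∈p∪⁅y⁆⁻ : ∀ (p : Subset n) {y z} → z ∈ p ∪ ⁅ y ⁆ → z ∈ p ⊎ z ≡ y
x∈p∪⁅y⁆⁻ p {y} z∈p∪y with x∈p∪q⁻ p ⁅ y ⁆ z∈p∪y
... | inj₁ z∈p = inj₁ z∈p
... | inj₂ z∈⁅y⁆ = inj₂ (x∈⁅y⁆⇒x≡y y z∈⁅y⁆)

x∉p⇒∣p∣<∣p∪⁅x⁆∣ : ∀ {p : Subset n} {x} → x ∉ p → ∣ p ∣ < ∣ p ∪ ⁅ x ⁆ ∣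
x∉p⇒∣p∣<∣p∪⁅x⁆∣ {p = p} {x} x∉p =
  p⊂q⇒∣p∣<∣q∣ (p⊆p∪q ⁅ x ⁆ , x , q⊆p∪q p ⁅ x ⁆ (x∈⁅x⁆ x) , x∉p)

module _ {A : Matrix n} {x y : Fin n} {R : Subset n} where

  lookup-newCands : ∀ z → lookup (newCands A x y R) z ≡ not (lookup R z) ∧ not ⌊ A z x ≟ A z y ⌋
  lookup-newCands = lookup∘tabulate _

  ∈-newCands⁻ : ∀ {z} → z ∈ newCands A x y R → z ∉ R × A z x ≢ A z y
  ∈-newCands⁻ {z} z∈C
    with lookup R z in R[z] | A z x ≟ A z y | trans (sym (lookup-newCands z)) ([]=⇒lookup z∈C)
  ... | outside | no separates | _ =
        (λ z∈R → contradiction (trans (sym ([]=⇒lookup z∈R)) R[z]) λ ()) , separates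
  ... | inside | _ | ()
  ... | outside | yes _ | ()

  ∉-newCands⁻ : ∀ {z} → z ∉ R → z ∉ newCands A x y R → A z x ≡ A z y
  ∉-newCands⁻ {z} z∉R z∉C with A z x ≟ A z y | lookup-newCands z
  ... | yes agree | _ = agree
  ... | no _ | C[z] =
        contradiction (lookup⇒[]= z _ (trans C[z] (cong (λ b → not b ∧ true) (x∉p⇒lookup≡outside z∉R)))) z∉C

module _ {A : Matrix n} where

  unsplit⇒IsModule : ∀ {M x} → (∀ {y z} → y ∈ M → z ∉ M → A z x ≡ A z y) → IsModule A M
  unsplit⇒IsModule unsplit m∈M m′∈M z∉M =
    (λ { refl → z∉M m∈M }) , (λ { refl → z∉M m′∈M }) ,
    trans (sym (unsplit m∈M z∉M)) (unsplit m′∈M z∉M)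

  newCands⊆IsModule : ∀ {N x y R} → IsModule A N → x ∈ N → y ∈ N → newCands A x y R ⊆ N
  newCands⊆IsModule {N} {x} {y} {R} mod x∈N y∈N {z} z∈C with z ∈? N
  ... | yes z∈N = z∈N
  ... | no z∉N =
        contradiction (proj₂ (proj₂ (mod x∈N y∈N z∉N))) (proj₂ (∈-newCands⁻ {A = A} {x} {y} {R} z∈C))

  newCands⊆SM : ∀ {S x y R} → x ∈SM (A , S) → y ∈SM (A , S) →
                ∀ {z} → z ∈ newCands A x y R → z ∈SM (A , S)
  newCands⊆SM {R = R} x∈SM y∈SM z∈C N mod S⊆N =
    newCands⊆IsModule {R = R} mod (x∈SM N mod S⊆N) (y∈SM N mod S⊆N) z∈C

module _ {p q r : Subset n} {y : Fin n} where

  ∪-move-⊇ : p ∪ q ⊆ (p ∪ ⁅ y ⁆) ∪ ((q - y) ∪ r)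
  ∪-move-⊇ {z} z∈p∪q with x∈p∪q⁻ p q z∈p∪q
  ... | inj₁ z∈p = x∈p∪q⁺ (inj₁ (p⊆p∪q ⁅ y ⁆ z∈p))
  ... | inj₂ z∈q with z ≟ y
  ...   | yes refl = x∈p∪q⁺ (inj₁ (q⊆p∪q p ⁅ y ⁆ (x∈⁅x⁆ y)))
  ...   | no z≢y = x∈p∪q⁺ (inj₂ (p⊆p∪q r (x∈p∧x≢y⇒x∈p-y z∈q z≢y)))

  ∪-move-⊆ : y ∈ q → (p ∪ ⁅ y ⁆) ∪ ((q - y) ∪ r) ⊆ (p ∪ q) ∪ r
  ∪-move-⊆ y∈q {z} z∈lhs with x∈p∪q⁻ (p ∪ ⁅ y ⁆) _ z∈lhs
  ... | inj₁ z∈p∪y with x∈p∪⁅y⁆⁻ p z∈p∪y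
  ...   | inj₁ z∈p = p⊆p∪q r (p⊆p∪q q z∈p)
  ...   | inj₂ refl = p⊆p∪q r (q⊆p∪q p q y∈q)
  ∪-move-⊆ y∈q {z} z∈lhs | inj₂ z∈q-y∪r with x∈p∪q⁻ (q - y) r z∈q-y∪r
  ... | inj₁ z∈q-y = p⊆p∪q r (q⊆p∪q p q (p─q⊆p q ⁅ y ⁆ z∈q-y))
  ... | inj₂ z∈r = q⊆p∪q (p ∪ q) r z∈r

record Invariant (A : Matrix n) (S : Subset n) (x : Fin n) (s : State n) : Set where
  field
    disjoint : ∀ {z} → z ∈ Mset s → z ∉ Fset s
    pivot∈M : x ∈ Mset s
    S⊆M∪F : S ⊆ Mset s ∪ Fset s
    M∪F⊆SM : ∀ {z} → z ∈ Mset s ∪ Fset s → z ∈SM (A , S)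
    outside-unsplit : ∀ {y z} → y ∈ Mset s → z ∉ Mset s ∪ Fset s → A z x ≡ A z y
    cost-bound : cost s ≤ 2 * n * ∣ Mset s ∣

cost-step : ∀ {c m m′} → 1 ≤ n → c ≤ 2 * n * m → m < m′ → c + suc n ≤ 2 * n * m′
cost-step {n} {c} {m} {m′} 1≤n c≤2nm m<m′ = begin
  c + suc n          ≤⟨ +-mono-≤ c≤2nm (+-mono-≤ 1≤n (m≤m+n n 0)) ⟩
  2 * n * m + 2 * n  ≡⟨ +-comm (2 * n * m) (2 * n) ⟩
  2 * n + 2 * n * m  ≡⟨ *-suc (2 * n) m ⟨
  2 * n * suc m      ≤⟨ *-monoʳ-≤ (2 * n) m<m′ ⟩
  2 * n * m′         ∎
  where open ≤-Reasoning

module _ {A : Matrix n} {S : Subset n} {x : Fin n} where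

  S⊆SM : ∀ {z} → z ∈ S → z ∈SM (A , S)
  S⊆SM z∈S _ _ S⊆N = S⊆N z∈S

  invariant-init : x ∈ S → Invariant A S x (initState S x)
  invariant-init x∈S = record
    { disjoint = λ z∈⁅x⁆ z∈S-x → x∈p-y⇒x≢y z∈S-x (x∈⁅y⁆⇒x≡y x z∈⁅x⁆)
    ; pivot∈M = x∈⁅x⁆ x
    ; S⊆M∪F = S⊆⁅x⁆∪S-x
    ; M∪F⊆SM = ⁅x⁆∪S-x⊆SM
    ; outside-unsplit = λ y∈⁅x⁆ _ → cong (A _) (sym (x∈⁅y⁆⇒x≡y x y∈⁅x⁆))
    ; cost-bound = n≤2n∣⁅x⁆∣
    }
    where
    S⊆⁅x⁆∪S-x : S ⊆ ⁅ x ⁆ ∪ (S - x)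
    S⊆⁅x⁆∪S-x {z} z∈S with z ≟ x
    ... | yes refl = p⊆p∪q (S - x) (x∈⁅x⁆ x)
    ... | no z≢x = q⊆p∪q ⁅ x ⁆ (S - x) (x∈p∧x≢y⇒x∈p-y z∈S z≢x)

    ⁅x⁆∪S-x⊆SM : ∀ {z} → z ∈ ⁅ x ⁆ ∪ (S - x) → z ∈SM (A , S)
    ⁅x⁆∪S-x⊆SM z∈M∪F with x∈p∪q⁻ ⁅ x ⁆ (S - x) z∈M∪F
    ... | inj₁ z∈⁅x⁆ rewrite x∈⁅y⁆⇒x≡y x z∈⁅x⁆ = S⊆SM x∈S
    ... | inj₂ z∈S-x = S⊆SM (p─q⊆p S ⁅ x ⁆ z∈S-x)

    n≤2n∣⁅x⁆∣ : n ≤ 2 * n * ∣ ⁅ x ⁆ ∣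
    n≤2n∣⁅x⁆∣ rewrite ∣⁅x⁆∣≡1 x | *-identityʳ (2 * n) = m≤m+n n (n + 0)

  M-grows : ∀ {s s′} → Invariant A S x s → Step A x s s′ → ∣ Mset s ∣ < ∣ Mset s′ ∣
  M-grows inv (step y∈F) = x∉p⇒∣p∣<∣p∪⁅x⁆∣ (λ y∈M → Invariant.disjoint inv y∈M y∈F)

  invariant-step : ∀ {s s′} → Invariant A S x s → Step A x s s′ → Invariant A S x s′
  invariant-step {⟨ M , F , c ⟩} inv (step {y = y} y∈F) = record
    { disjoint = disjoint′
    ; pivot∈M = p⊆p∪q ⁅ y ⁆ pivot∈M
    ; S⊆M∪F = λ z∈S → ∪-move-⊇ (S⊆M∪F z∈S)
    ; M∪F⊆SM = M′∪F′⊆SM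
    ; outside-unsplit = outside-unsplit′
    ; cost-bound = cost-step (>-nonZero⁻¹ n {{nonZeroIndex x}}) cost-bound (M-grows inv (step y∈F))
    }
    where
    open Invariant inv
    M′ = M ∪ ⁅ y ⁆
    C = newCands A x y (M′ ∪ (F - y))

    disjoint′ : ∀ {z} → z ∈ M′ → z ∉ (F - y) ∪ C
    disjoint′ z∈M′ z∈F′ with x∈p∪q⁻ (F - y) C z∈F′
    ... | inj₂ z∈C = proj₁ (∈-newCands⁻ {A = A} {x} {y} z∈C) (p⊆p∪q (F - y) z∈M′)
    ... | inj₁ z∈F-y with x∈p∪⁅y⁆⁻ M z∈M′
    ...   | inj₁ z∈M = disjoint z∈M (p─q⊆p F ⁅ y ⁆ z∈F-y)
    ...   | inj₂ z≡y = x∈p-y⇒x≢y z∈F-y z≡y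

    M′∪F′⊆SM : ∀ {z} → z ∈ M′ ∪ ((F - y) ∪ C) → z ∈SM (A , S)
    M′∪F′⊆SM z∈M′∪F′ with x∈p∪q⁻ (M ∪ F) C (∪-move-⊆ y∈F z∈M′∪F′)
    ... | inj₁ z∈M∪F = M∪F⊆SM z∈M∪F
    ... | inj₂ z∈C =
          newCands⊆SM {R = M′ ∪ (F - y)} (M∪F⊆SM (p⊆p∪q F pivot∈M)) (M∪F⊆SM (q⊆p∪q M F y∈F)) z∈C

    outside-unsplit′ : ∀ {y′ z} → y′ ∈ M′ → z ∉ M′ ∪ ((F - y) ∪ C) → A z x ≡ A z y′
    outside-unsplit′ y′∈M′ z∉M′∪F′ with x∈p∪⁅y⁆⁻ M y′∈M′
    ... | inj₁ y′∈M = outside-unsplit y′∈M (λ z∈M∪F → z∉M′∪F′ (∪-move-⊇ z∈M∪F))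
    ... | inj₂ refl = ∉-newCands⁻ {A = A} {x} {y}
          (λ z∈R → z∉M′∪F′ (subst (_ ∈_) (∪-assoc M′ (F - y) C) (p⊆p∪q C z∈R)))
          (λ z∈C → z∉M′∪F′ (q⊆p∪q M′ _ (q⊆p∪q (F - y) C z∈C)))

  invariant-run : ∀ {s s′} → Invariant A S x s → Star (Step A x) s s′ → Invariant A S x s′
  invariant-run inv ε = inv
  invariant-run inv (st ◅ run) = invariant-run (invariant-step inv st) run

  accessible : ∀ {s} → Invariant A S x s → Acc _<_ (n ∸ ∣ Mset s ∣) → Acc (λ s′ s → Step A x s s′) s
  accessible inv (acc smaller) = acc λ {s′} st →
    accessible (invariant-step inv st) (smaller (∸-monoʳ-< (M-grows inv st) (∣p∣≤n (Mset s′))))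

  terminal⇒M≡SM : ∀ {s} → Invariant A S x s → Terminal s → ∀ z → z ∈ Mset s ⇔ z ∈SM (A , S)
  terminal⇒M≡SM {s} inv done z =
    mk⇔ (λ z∈M → M∪F⊆SM (p⊆p∪q (Fset s) z∈M)) (λ z∈SM → z∈SM (Mset s) M-module S⊆M)
    where
    open Invariant inv

    M∪F⊆M : Mset s ∪ Fset s ⊆ Mset s
    M∪F⊆M z∈M∪F with x∈p∪q⁻ (Mset s) (Fset s) z∈M∪F
    ... | inj₁ z∈M = z∈M
    ... | inj₂ z∈F = ⊥-elim (done (_ , z∈F))

    M-module : IsModule A (Mset s)
    M-module = unsplit⇒IsModule λ y∈M z∉M → outside-unsplit y∈M (λ z∈M∪F → z∉M (M∪F⊆M z∈M∪F))

    S⊆M : S ⊆ Mset s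
    S⊆M z∈S = M∪F⊆M (S⊆M∪F z∈S)

theorem5 : ∃ λ (c : ℕ) → ∀ (n : ℕ) (A : Matrix n) (S : Subset n) → Nonempty S →
    ∀ (x : Fin n) → x ∈ S →
      Acc (λ s' s → Step A x s s') (initState S x)
      × (∀ (s : State n) → Star (Step A x) (initState S x) s → Terminal s →
           (∀ (z : Fin n) → (z ∈ Mset s) ⇔ (z ∈SM (A , S)))
           × (cost s ≤ c * n * ∣ Mset s ∣))
theorem5 = 2 , λ n A S _ x x∈S →
  let inv₀ = invariant-init x∈S in
  accessible inv₀ (<-wellFounded _) ,
  λ s run done → let inv = invariant-run inv₀ run in
    terminal⇒M≡SM inv done , Invariant.cost-bound inv
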